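{- Let $p$ be a prime and let $f_1:\mathbb{N}_0\to\mathbb{C}$, $f_2:\mathbb{N}\to\mathbb{C}$ be eventually periodic sequences with $f_1(0)=1$ and $f_2$ multiplicative. Then the sequence $n\mapsto f_1(\nu_p(n))\,f_2(n/p^{\nu_p(n)})$ on $\mathbb{N}$ is multiplicative and $p$-automatic.
   Context: A sequence $u:\mathbb{N}\to\mathbb{C}$ is multiplicative if $u(mn)=u(m)u(n)$ for all coprime $m,n$. $\nu_p(n)$ denotes the $p$-adic valuation of $n$. A sequence $f$ is $p$-automatic if its $p$-kernel $\{(f(np^k+r))_{n\ge0}:k\ge0,\ 0\le r<p^k\}$ is finite. -}

module Defs where

open import Level using (Level; _⊔_)
open import Data.Nat using (ℕ; zero; suc; _+_; _*_; _^_; _≤_; _<_)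
open import Data.Nat.Divisibility using (_∣?_; divides)
open import Data.Nat.Coprimality using (Coprime)
open import Data.Product using (Σ; _×_; _,_; ∃-syntax)
open import Data.List using (List)
open import Data.List.Relation.Unary.Any using (Any)
open import Relation.Nullary using (yes; no)
open import Algebra.Bundles using (CommutativeMonoid)

-- p-adic splitting: splitAux p fuel n = (ν, m) where n = p^ν * m, p ∤ m
-- (for p ≥ 2, n ≥ 1 and fuel ≥ n the fuel never runs out).
splitAux : ℕ → ℕ → ℕ → ℕ × ℕ
splitAux p zero    n = (0 , n)
splitAux p (suc k) zero = (0 , 0)
splitAux p (suc k) (suc n) with p ∣? suc n
... | yes (divides q _) with splitAux p k q
...   | (v , m) = (suc v , m)
splitAux p (suc k) (suc n) | no _ = (0 , suc n)

ν : ℕ → ℕ → ℕ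
ν p n = Data.Product.proj₁ (splitAux p n n)

unitPart : ℕ → ℕ → ℕ
unitPart p n = Data.Product.proj₂ (splitAux p n n)

module _ {c ℓ : Level} (M : CommutativeMonoid c ℓ) where
  open CommutativeMonoid M renaming (Carrier to A)

  EventuallyPeriodic : (ℕ → A) → Set ℓ
  EventuallyPeriodic f = ∃[ N ] ∃[ T ] (0 < T × (∀ n → N ≤ n → f (n + T) ≈ f n))

  Multiplicative : (ℕ → A) → Set ℓ
  Multiplicative u = ∀ m n → 1 ≤ m → 1 ≤ n → Coprime m n → u (m * n) ≈ u m ∙ u n

  -- p-automatic: the p-kernel is finite (up to pointwise equality)
  Automatic : ℕ → (ℕ → A) → Set (c ⊔ ℓ)
  Automatic p f = Σ (List (ℕ → A)) λ L → (∀ k r → r < p ^ k →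
      Any (λ (g : ℕ → A) → ∀ n → f (n * p ^ k + r) ≈ g n) L)

  combined : ℕ → A → (ℕ → A) → (ℕ → A) → ℕ → A
  combined p c₀ f₁ f₂ zero = c₀
  combined p c₀ f₁ f₂ (suc n) = f₁ (ν p (suc n)) ∙ f₂ (unitPart p (suc n))

module Submission where

-- Let C(n) = f₁(ν_p(n)) · f₂(n / p^ν_p(n)); for p ∤ u, C(p^v·u) = f₁(v)·f₂(u).
--
-- Multiplicativity: of coprime m, n at most one is divisible by p, say p ∤ n.
-- With m = p^a·u, m·n = p^a·(u·n) and p ∤ u·n, while C(n) = f₂(n) as
-- f₁(0) = 1; multiplicativity of f₂ then gives C(mn) = C(m)·C(n).
--
-- Automaticity: an eventually periodic f (preperiod N, period T) is unchanged
-- when any index is reduced below N + T, so every arithmetic subsequence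
-- n ↦ f(n·d + s) equals one with d, s < N + T: a finite family.  A kernel
-- entry n ↦ C(n·p^k + r) is, for r = 0, the entry of the reduced exponent k,
-- and for r = p^v·s (p ∤ s, v < k) the sequence f₁(v)·f₂(n·p^(k-v) + s).

open import Defs
open import Level using (Level; _⊔_)
open import Data.Nat hiding (_⊔_)
open import Data.Nat.Properties
open import Data.Nat.Divisibility
open import Data.Nat.DivMod using (_%_; _/_; m≡m%n+[m/n]*n; m%n<n)
open import Data.Nat.Coprimality as Coprimality using (Coprime)
open import Data.Nat.Primality using (Prime; euclidsLemma; prime⇒nonTrivial)
open import Data.Nat.Tactic.RingSolver using (solve-∀)
open import Data.Product using (∃-syntax; _×_; _,_; proj₁; proj₂; map₁)
open import Data.Sum using (_⊎_; inj₁; inj₂; [_,_]′)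
open import Data.Empty using (⊥-elim)
open import Data.List using (List; upTo; applyUpTo; cartesianProductWith; _++_)
open import Data.List.Relation.Unary.Any as Any using (Any)
open import Data.List.Relation.Unary.Any.Properties
  using (++⁺ˡ; ++⁺ʳ; applyUpTo⁺; cartesianProductWith⁺)
open import Data.List.Membership.Propositional.Properties using (∈-upTo⁺; ∈-applyUpTo⁺)
open import Relation.Nullary using (¬_; yes; no)
open import Relation.Binary.PropositionalEquality as ≡ using (_≡_; refl; cong; cong₂)
open import Algebra.Bundles using (CommutativeMonoid)
import Relation.Binary.Reasoning.Setoid as SetoidReasoning

-- The arithmetic subsequence n ↦ f(n·d + s); the p-kernel of f consists of
-- the subsequences with d = p^k and s < p^k.
subsequence : ∀ {a} {X : Set a} → (ℕ → X) → ℕ → ℕ → ℕ → X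
subsequence f d s n = f (n * d + s)

module PAdic (p : ℕ) (1<p : 1 < p) where

  instance
    p≢0 : NonZero p
    p≢0 = >-nonZero (<-trans z<s 1<p)

  indivisible⇒positive : ∀ {m} → ¬ p ∣ m → 1 ≤ m
  indivisible⇒positive {zero}  p∤0 = ⊥-elim (p∤0 (p ∣0))
  indivisible⇒positive {suc m} _   = s≤s z≤n

  p∣p^[1+v]*m : ∀ v m → p ∣ p ^ suc v * m
  p∣p^[1+v]*m v m = ∣-trans (m∣m*n (p ^ v)) (m∣m*n m)

  indivisible-shift : ∀ {s} → ¬ p ∣ s → ∀ n J → ¬ p ∣ n * p ^ suc J + s
  indivisible-shift p∤s n J p∣sum =
    p∤s (∣m+n∣m⇒∣n p∣sum (∣-trans (m∣m*n (p ^ J)) (n∣m*n n)))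

  factorisation-unique : ∀ v v′ m m′ → p ^ v * m ≡ p ^ v′ * m′ →
                         ¬ p ∣ m → ¬ p ∣ m′ → v ≡ v′ × m ≡ m′
  factorisation-unique zero zero m m′ eq _ _ =
    refl , ≡.trans (≡.sym (*-identityˡ m)) (≡.trans eq (*-identityˡ m′))
  factorisation-unique zero (suc v′) m m′ eq p∤m _ =
    ⊥-elim (p∤m (≡.subst (p ∣_) (≡.trans (≡.sym eq) (*-identityˡ m)) (p∣p^[1+v]*m v′ m′)))
  factorisation-unique (suc v) zero m m′ eq _ p∤m′ =
    ⊥-elim (p∤m′ (≡.subst (p ∣_) (≡.trans eq (*-identityˡ m′)) (p∣p^[1+v]*m v m)))
  factorisation-unique (suc v) (suc v′) m m′ eq p∤m p∤m′ =
    map₁ (cong suc) (factorisation-unique v v′ m m′ cancelled p∤m p∤m′)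
    where
    cancelled : p ^ v * m ≡ p ^ v′ * m′
    cancelled = *-cancelˡ-≡ _ _ p
      (≡.trans (≡.sym (*-assoc p (p ^ v) m)) (≡.trans eq (*-assoc p (p ^ v′) m′)))

  quotient-bounds : ∀ {n q} → 1 ≤ n → n ≡ q * p → 1 ≤ q × q < n
  quotient-bounds {q = zero}  (s≤s _) ()
  quotient-bounds {q = suc q} _ refl = s≤s z≤n , m<m*n (suc q) p 1<p

  splitAux-spec : ∀ fuel n → n ≤ fuel → 1 ≤ n →
    n ≡ p ^ proj₁ (splitAux p fuel n) * proj₂ (splitAux p fuel n) × ¬ p ∣ proj₂ (splitAux p fuel n)
  splitAux-spec (suc k) (suc n) n≤k _ with p ∣? suc n
  ... | no p∤n = ≡.sym (*-identityˡ (suc n)) , p∤n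
  ... | yes (divides q n≡q*p)
    with splitAux p k q
       | splitAux-spec k q (≤-pred (≤-trans (proj₂ bounds) n≤k)) (proj₁ bounds)
    where
    bounds : 1 ≤ q × q < suc n
    bounds = quotient-bounds (s≤s z≤n) n≡q*p
  ...   | (v , m) | (q≡p^v*m , p∤m) =
    ≡.trans n≡q*p (≡.trans (cong (_* p) q≡p^v*m) (rearrange (p ^ v) m p)) , p∤m
    where
    rearrange : ∀ a b c → a * b * c ≡ c * a * b
    rearrange = solve-∀

  valuation-spec : ∀ n → 1 ≤ n → n ≡ p ^ ν p n * unitPart p n × ¬ p ∣ unitPart p n
  valuation-spec n = splitAux-spec n n ≤-refl

  power-times-unit-positive : ∀ v {m} → ¬ p ∣ m → 1 ≤ p ^ v * m
  power-times-unit-positive v p∤m = *-mono-≤ (m^n>0 p v) (indivisible⇒positive p∤m)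

  valuation-unique : ∀ v m → ¬ p ∣ m → ν p (p ^ v * m) ≡ v × unitPart p (p ^ v * m) ≡ m
  valuation-unique v m p∤m =
    factorisation-unique _ v _ m (≡.sym (proj₁ spec)) (proj₂ spec) p∤m
    where
    spec : p ^ v * m ≡ p ^ ν p (p ^ v * m) * unitPart p (p ^ v * m) × ¬ p ∣ unitPart p (p ^ v * m)
    spec = valuation-spec (p ^ v * m) (power-times-unit-positive v p∤m)

  exponent-bound : ∀ {v r k} → p ^ v ≤ r → r < p ^ k → v < k
  exponent-bound p^v≤r r<p^k =
    ≰⇒> λ k≤v → <-irrefl refl (<-≤-trans r<p^k (≤-trans (^-monoʳ-≤ p k≤v) p^v≤r))

  residue-split : ∀ k r → 1 ≤ r → r < p ^ k →
    ∃[ v ] ∃[ J ] ∃[ s ] (k ≡ v + suc J × r ≡ p ^ v * s × ¬ p ∣ s)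
  residue-split k r 1≤r r<p^k =
    ν p r , k ∸ suc (ν p r) , unitPart p r , k≡ , r≡ , p∤s
    where
    r≡ : r ≡ p ^ ν p r * unitPart p r
    r≡ = proj₁ (valuation-spec r 1≤r)
    p∤s : ¬ p ∣ unitPart p r
    p∤s = proj₂ (valuation-spec r 1≤r)
    instance
      s≢0 : NonZero (unitPart p r)
      s≢0 = >-nonZero (indivisible⇒positive p∤s)
    v<k : ν p r < k
    v<k = exponent-bound (≤-trans (m≤m*n (p ^ ν p r) (unitPart p r)) (≤-reflexive (≡.sym r≡))) r<p^k
    k≡ : k ≡ ν p r + suc (k ∸ suc (ν p r))
    k≡ = ≡.sym (≡.trans (+-suc (ν p r) _) (m+[n∸m]≡n v<k))

module Reduction (N T : ℕ) .{{_ : NonZero T}} where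

  reduce : ℕ → ℕ
  reduce m with m <? N
  ... | yes _ = m
  ... | no  _ = N + (m ∸ N) % T

  reduce-bound : ∀ m → reduce m < N + T
  reduce-bound m with m <? N
  ... | yes m<N = ≤-trans m<N (m≤m+n N T)
  ... | no  _   = +-monoʳ-< N (m%n<n (m ∸ N) T)

  reduce-spec : ∀ m → reduce m ≡ m ⊎ (N ≤ reduce m × ∃[ c ] m ≡ reduce m + c * T)
  reduce-spec m with m <? N
  ... | yes _   = inj₁ refl
  ... | no  m≮N = inj₂ (m≤m+n N _ , (m ∸ N) / T , m≡)
    where
    m≡ : m ≡ N + (m ∸ N) % T + (m ∸ N) / T * T
    m≡ = ≡.trans (≡.sym (m+[n∸m]≡n (≮⇒≥ m≮N)))
           (≡.trans (cong (N +_) (m≡m%n+[m/n]*n (m ∸ N) T)) (≡.sym (+-assoc N _ _)))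

module _ {c ℓ : Level} (M : CommutativeMonoid c ℓ) where
  open CommutativeMonoid M renaming (Carrier to A; refl to ≈-refl)
  open SetoidReasoning setoid

  infix 4 _≐_ _∈≈_

  _≐_ : (ℕ → A) → (ℕ → A) → Set ℓ
  g ≐ h = ∀ n → g n ≈ h n

  _∈≈_ : (ℕ → A) → List (ℕ → A) → Set (c ⊔ ℓ)
  g ∈≈ L = Any (g ≐_) L

  ∈≈-resp : ∀ {g h L} → g ≐ h → h ∈≈ L → g ∈≈ L
  ∈≈-resp g≐h = Any.map (λ h≐k n → trans (g≐h n) (h≐k n))

  scale : A → (ℕ → A) → ℕ → A
  scale w g n = w ∙ g n

  module EventuallyPeriodicSequence (f : ℕ → A) (ep : EventuallyPeriodic M f) where
    N T : ℕ
    N = proj₁ ep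
    T = proj₁ (proj₂ ep)

    instance
      T≢0 : NonZero T
      T≢0 = >-nonZero (proj₁ (proj₂ (proj₂ ep)))

    open Reduction N T public

    step : ∀ x → N ≤ x → f (x + T) ≈ f x
    step = proj₂ (proj₂ (proj₂ ep))

    periodic : ∀ x c → N ≤ x → f (x + c * T) ≈ f x
    periodic x zero    N≤x = reflexive (cong f (+-identityʳ x))
    periodic x (suc c) N≤x = begin
      f (x + (T + c * T)) ≡⟨ cong f (≡.trans (cong (x +_) (+-comm T (c * T))) (≡.sym (+-assoc x _ T))) ⟩
      f (x + c * T + T)   ≈⟨ step (x + c * T) (≤-trans N≤x (m≤m+n x _)) ⟩
      f (x + c * T)       ≈⟨ periodic x c N≤x ⟩
      f x                 ∎

    reduce-shift : ∀ x m → f (x + m) ≈ f (x + reduce m)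
    reduce-shift x m with reduce-spec m
    ... | inj₁ r≡m = reflexive (cong (λ k → f (x + k)) (≡.sym r≡m))
    ... | inj₂ (N≤r , c , m≡r+cT) = begin
      f (x + m)                ≡⟨ cong f (≡.trans (cong (x +_) m≡r+cT) (≡.sym (+-assoc x _ _))) ⟩
      f (x + reduce m + c * T) ≈⟨ periodic (x + reduce m) c (≤-trans N≤r (m≤n+m _ x)) ⟩
      f (x + reduce m)         ∎

    -- Both the step d and the offset s of a subsequence may be reduced;
    -- reducing d is harmless since n·d + s ≥ N once n ≥ 1 and d ≥ N.
    subsequence-reduce : ∀ d s → subsequence f d s ≐ subsequence f (reduce d) (reduce s)
    subsequence-reduce d s zero = reduce-shift 0 s
    subsequence-reduce d s n@(suc _) with reduce-spec d
    ... | inj₁ r≡d = trans (reduce-shift (n * d) s)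
                           (reflexive (cong (λ e → f (n * e + reduce s)) (≡.sym r≡d)))
    ... | inj₂ (N≤r , c , d≡r+cT) = begin
      f (n * d + s)                         ≈⟨ reduce-shift (n * d) s ⟩
      f (n * d + reduce s)                  ≡⟨ cong f (≡.trans (cong (λ e → n * e + reduce s) d≡r+cT)
                                                 (expand n (reduce d) c T (reduce s))) ⟩
      f (n * reduce d + reduce s + n * c * T) ≈⟨ periodic _ (n * c) N≤ ⟩
      f (n * reduce d + reduce s)           ∎
      where
      expand : ∀ n r c T s → n * (r + c * T) + s ≡ n * r + s + n * c * T
      expand = solve-∀
      N≤ : N ≤ n * reduce d + reduce s
      N≤ = ≤-trans N≤r (≤-trans (m≤n*m (reduce d) n) (m≤m+n _ (reduce s)))

    subsequences : List (ℕ → A)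
    subsequences = cartesianProductWith (subsequence f) (upTo (N + T)) (upTo (N + T))

    subsequences-complete : ∀ d s → subsequence f d s ∈≈ subsequences
    subsequences-complete d s =
      cartesianProductWith⁺ (subsequence f) reduced
        (∈-upTo⁺ (reduce-bound d)) (∈-upTo⁺ (reduce-bound s))
      where
      reduced : ∀ {d′ s′} → reduce d ≡ d′ → reduce s ≡ s′ →
                subsequence f d s ≐ subsequence f d′ s′
      reduced refl refl = subsequence-reduce d s

  module Combined (p : ℕ) (pr : Prime p) (c₀ : A) (f₁ f₂ : ℕ → A) where
    1<p : 1 < p
    1<p = nonTrivial⇒n>1 p {{prime⇒nonTrivial pr}}

    open PAdic p 1<p

    C : ℕ → A
    C = combined M p c₀ f₁ f₂

    combined-positive : ∀ n → 1 ≤ n → C n ≡ f₁ (ν p n) ∙ f₂ (unitPart p n)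
    combined-positive (suc n) _ = refl

    combined-eval : ∀ v m → ¬ p ∣ m → C (p ^ v * m) ≈ f₁ v ∙ f₂ m
    combined-eval v m p∤m = begin
      C (p ^ v * m)                                       ≡⟨ combined-positive _ (power-times-unit-positive v p∤m) ⟩
      f₁ (ν p (p ^ v * m)) ∙ f₂ (unitPart p (p ^ v * m)) ≡⟨ cong₂ (λ a b → f₁ a ∙ f₂ b) (proj₁ unique) (proj₂ unique) ⟩
      f₁ v ∙ f₂ m                                         ∎
      where
      unique : ν p (p ^ v * m) ≡ v × unitPart p (p ^ v * m) ≡ m
      unique = valuation-unique v m p∤m

    combined-unit : f₁ 0 ≈ ε → ∀ {n} → ¬ p ∣ n → C n ≈ f₂ n
    combined-unit f₁0≈ε {n} p∤n = begin
      C n         ≡⟨ cong C (≡.sym (*-identityˡ n)) ⟩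
      C (1 * n)   ≈⟨ combined-eval 0 n p∤n ⟩
      f₁ 0 ∙ f₂ n ≈⟨ ∙-congʳ f₁0≈ε ⟩
      ε ∙ f₂ n    ≈⟨ identityˡ (f₂ n) ⟩
      f₂ n        ∎

    -- The multiplicativity step when the second factor is prime to p:
    -- with m = p^a·u we get m·n = p^a·(u·n) and p ∤ u·n.
    multiplicative-prime-to-p : f₁ 0 ≈ ε → Multiplicative M f₂ →
      ∀ m n → 1 ≤ m → Coprime m n → ¬ p ∣ n → C (m * n) ≈ C m ∙ C n
    multiplicative-prime-to-p f₁0≈ε mult₂ m n 1≤m m⊥n p∤n = begin
      C (m * n)              ≡⟨ cong C (≡.trans (cong (_* n) m≡) (*-assoc (p ^ a) u n)) ⟩
      C (p ^ a * (u * n))    ≈⟨ combined-eval a (u * n) p∤un ⟩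
      f₁ a ∙ f₂ (u * n)      ≈⟨ ∙-congˡ (mult₂ u n (indivisible⇒positive p∤u) (indivisible⇒positive p∤n) u⊥n) ⟩
      f₁ a ∙ (f₂ u ∙ f₂ n)   ≈⟨ sym (assoc _ _ _) ⟩
      f₁ a ∙ f₂ u ∙ f₂ n     ≈⟨ ∙-cong (sym (combined-eval a u p∤u)) (sym (combined-unit f₁0≈ε p∤n)) ⟩
      C (p ^ a * u) ∙ C n    ≡⟨ cong (λ k → C k ∙ C n) (≡.sym m≡) ⟩
      C m ∙ C n              ∎
      where
      a = ν p m
      u = unitPart p m
      m≡ : m ≡ p ^ a * u
      m≡ = proj₁ (valuation-spec m 1≤m)
      p∤u : ¬ p ∣ u
      p∤u = proj₂ (valuation-spec m 1≤m)
      p∤un : ¬ p ∣ u * n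
      p∤un p∣un = [ p∤u , p∤n ]′ (euclidsLemma u n pr p∣un)
      u⊥n : Coprime u n
      u⊥n (d∣u , d∣n) = m⊥n (∣-trans d∣u (divides (p ^ a) m≡) , d∣n)

    -- Of two coprime numbers at most one is divisible by p; by symmetry
    -- it may be taken to be the first.
    combined-multiplicative : f₁ 0 ≈ ε → Multiplicative M f₂ → Multiplicative M C
    combined-multiplicative f₁0≈ε mult₂ m n 1≤m 1≤n m⊥n with p ∣? n | p ∣? m
    ... | no p∤n | _ = multiplicative-prime-to-p f₁0≈ε mult₂ m n 1≤m m⊥n p∤n
    ... | yes _ | no p∤m = begin
      C (m * n) ≡⟨ cong C (*-comm m n) ⟩
      C (n * m) ≈⟨ multiplicative-prime-to-p f₁0≈ε mult₂ n m 1≤n (Coprimality.sym m⊥n) p∤m ⟩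
      C n ∙ C m ≈⟨ comm (C n) (C m) ⟩
      C m ∙ C n ∎
    ... | yes p∣n | yes p∣m = ⊥-elim (>⇒≢ 1<p (m⊥n (p∣m , p∣n)))

    module Kernel (ep₁ : EventuallyPeriodic M f₁) (ep₂ : EventuallyPeriodic M f₂) where
      module F₁ = EventuallyPeriodicSequence f₁ ep₁
      module F₂ = EventuallyPeriodicSequence f₂ ep₂

      -- For n = p^v·u, C(n·p^k) = f₁(v + k)·f₂(u), so k may be reduced.
      kernel-at-zero : ∀ k → subsequence C (p ^ k) 0 ≐ subsequence C (p ^ F₁.reduce k) 0
      kernel-at-zero k zero = ≈-refl
      kernel-at-zero k n@(suc _) = begin
        C (n * p ^ k + 0)              ≈⟨ eval k ⟩
        f₁ (v + k) ∙ f₂ u              ≈⟨ ∙-congʳ (F₁.reduce-shift v k) ⟩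
        f₁ (v + F₁.reduce k) ∙ f₂ u    ≈⟨ sym (eval (F₁.reduce k)) ⟩
        C (n * p ^ F₁.reduce k + 0)    ∎
        where
        v = ν p n
        u = unitPart p n
        rearrange : ∀ a b u → a * u * b + 0 ≡ a * b * u
        rearrange = solve-∀
        eval : ∀ j → C (n * p ^ j + 0) ≈ f₁ (v + j) ∙ f₂ u
        eval j = begin
          C (n * p ^ j + 0)       ≡⟨ cong C (≡.trans (cong (λ e → e * p ^ j + 0) (proj₁ (valuation-spec n (s≤s z≤n))))
                                      (≡.trans (rearrange (p ^ v) (p ^ j) u) (cong (_* u) (≡.sym (^-distribˡ-+-* p v j))))) ⟩
          C (p ^ (v + j) * u)     ≈⟨ combined-eval (v + j) u (proj₂ (valuation-spec n (s≤s z≤n))) ⟩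
          f₁ (v + j) ∙ f₂ u       ∎

      kernel-at-unit : ∀ v J s → ¬ p ∣ s →
        subsequence C (p ^ (v + suc J)) (p ^ v * s) ≐ scale (f₁ v) (subsequence f₂ (p ^ suc J) s)
      kernel-at-unit v J s p∤s n = begin
        C (n * p ^ (v + suc J) + p ^ v * s) ≡⟨ cong C (≡.trans (cong (λ e → n * e + p ^ v * s) (^-distribˡ-+-* p v (suc J)))
                                                 (factor n (p ^ v) (p ^ suc J) s)) ⟩
        C (p ^ v * (n * p ^ suc J + s))    ≈⟨ combined-eval v _ (indivisible-shift p∤s n J) ⟩
        f₁ v ∙ f₂ (n * p ^ suc J + s)      ∎
        where
        factor : ∀ n a b s → n * (a * b) + a * s ≡ a * (n * b + s)
        factor = solve-∀

      kernel : List (ℕ → A)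
      kernel = applyUpTo (λ k → subsequence C (p ^ k) 0) (F₁.N + F₁.T)
            ++ cartesianProductWith scale (applyUpTo f₁ (F₁.N + F₁.T)) F₂.subsequences

      kernel-complete-unit : ∀ v J s → ¬ p ∣ s → subsequence C (p ^ (v + suc J)) (p ^ v * s) ∈≈ kernel
      kernel-complete-unit v J s p∤s =
        ++⁺ʳ _ (∈≈-resp (kernel-at-unit v J s p∤s)
          (cartesianProductWith⁺ scale scaled (∈-applyUpTo⁺ f₁ (F₁.reduce-bound v))
            (F₂.subsequences-complete (p ^ suc J) s)))
        where
        scaled : ∀ {w g} → f₁ (F₁.reduce v) ≡ w → subsequence f₂ (p ^ suc J) s ≐ g →
                 scale (f₁ v) (subsequence f₂ (p ^ suc J) s) ≐ scale w g
        scaled refl sub≐g n = ∙-cong (F₁.reduce-shift 0 v) (sub≐g n)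

      kernel-complete : ∀ k r → r < p ^ k → subsequence C (p ^ k) r ∈≈ kernel
      kernel-complete k zero _ = ++⁺ˡ (applyUpTo⁺ _ (kernel-at-zero k) (F₁.reduce-bound k))
      kernel-complete k r@(suc _) r<p^k with residue-split k r (s≤s z≤n) r<p^k
      ... | v , J , s , k≡ , r≡ , p∤s =
        ≡.subst₂ (λ k r → subsequence C (p ^ k) r ∈≈ kernel) (≡.sym k≡) (≡.sym r≡)
          (kernel-complete-unit v J s p∤s)

      automatic : Automatic M p C
      automatic = kernel , kernel-complete

lemma3p4 : {c ℓ : Level} (M : CommutativeMonoid c ℓ) (p : ℕ) → Prime p →
    (f₁ f₂ : ℕ → CommutativeMonoid.Carrier M) →
    EventuallyPeriodic M f₁ → EventuallyPeriodic M f₂ →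
    CommutativeMonoid._≈_ M (f₁ 0) (CommutativeMonoid.ε M) →
    Multiplicative M f₂ →
    (c₀ : CommutativeMonoid.Carrier M) →
    Multiplicative M (combined M p c₀ f₁ f₂) × Automatic M p (combined M p c₀ f₁ f₂)
lemma3p4 M p pr f₁ f₂ ep₁ ep₂ f₁0≈ε mult₂ c₀ =
  combined-multiplicative f₁0≈ε mult₂ , automatic
  where
  open Combined M p pr c₀ f₁ f₂
  open Kernel ep₁ ep₂
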